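{- Let $G$ be a graph without isolated vertices and without false twins. Then $\gamma_{OLD}(M(G))\le\gamma_{OLD}(G)+2$.
   Context: All graphs are finite, simple and connected. For a graph $G=(V,E)$ and $x\in V$, $N(x)$ is the open neighbourhood. Two distinct vertices $x,y$ are false twins if $N(x)=N(y)$. A set $C\subseteq V$ is an open locating-dominating set ($OLD$-set) if $N(x)\cap C\neq\emptyset$ for all $x\in V$ and $N(x)\cap C\ne N(y)\cap C$ for all distinct $x,y\in V$; $\gamma_{OLD}(G)$ is the minimum size of an $OLD$-set. The Mycielski graph $M(G)$ of $G$ with $V=\{v_1,\dots,v_n\}$ is obtained from $G$ by adding, for each $i$, a new vertex $u_i$ adjacent to every vertex of $N_G(v_i)$, and then adding one further vertex $u$ adjacent to all of $u_1,\dots,u_n$ (and to nothing else). -}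

module Defs where

open import Data.Nat using (ℕ; zero; suc; _+_; _≤_)
open import Data.Fin using (Fin; zero; suc; splitAt)
open import Data.Fin.Subset using (Subset; _∈_; ∣_∣)
open import Data.Bool using (Bool; true; false; _∧_)
open import Data.Sum using (inj₁; inj₂)
open import Data.Vec using (lookup)
open import Data.Product using (Σ; _×_; ∃)
open import Relation.Binary.PropositionalEquality using (_≡_; _≢_; refl)
open import Relation.Nullary using (¬_)

record Graph (n : ℕ) : Set where
  field
    adj    : Fin n → Fin n → Bool
    sym    : ∀ x y → adj x y ≡ adj y x
    irrefl : ∀ x → adj x x ≡ false
open Graph public

_∈N[_]_ : ∀ {n} → Fin n → Graph n → Fin n → Set
y ∈N[ G ] x = adj G x y ≡ true

data Reach {n} (G : Graph n) : Fin n → Fin n → Set where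
  here : ∀ {x} → Reach G x x
  step : ∀ {x y z} → adj G x y ≡ true → Reach G y z → Reach G x z

Connected : ∀ {n} → Graph n → Set
Connected {n} G = ∀ (x y : Fin n) → Reach G x y

NoIsolated : ∀ {n} → Graph n → Set
NoIsolated {n} G = ∀ (x : Fin n) → ∃ λ y → y ∈N[ G ] x

FalseTwins : ∀ {n} → Graph n → Fin n → Fin n → Set
FalseTwins {n} G x y = x ≢ y × (∀ (z : Fin n) → adj G x z ≡ adj G y z)

NoFalseTwins : ∀ {n} → Graph n → Set
NoFalseTwins {n} G = ∀ (x y : Fin n) → ¬ FalseTwins G x y

NC : ∀ {n} → Graph n → Subset n → Fin n → Fin n → Bool
NC G C x z = adj G x z ∧ lookup C z

IsOLD : ∀ {n} → Graph n → Subset n → Set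
IsOLD {n} G C =
  (∀ (x : Fin n) → ∃ λ y → (y ∈N[ G ] x) × (y ∈ C))
  × (∀ (x y : Fin n) → x ≢ y → ¬ (∀ (z : Fin n) → NC G C x z ≡ NC G C y z))

IsγOLD : ∀ {n} → Graph n → ℕ → Set
IsγOLD G k = (Σ _ λ C → IsOLD G C × ∣ C ∣ ≡ k) × (∀ C → IsOLD G C → k ≤ ∣ C ∣)

-- Mycielski graph. Vertex set Fin (suc (n + n)):
--   zero             = u
--   suc (i ↑ˡ n)     = v_i   (splitAt gives inj₁ i)
--   suc (n ↑ʳ i)     = u_i   (splitAt gives inj₂ i)
data MV (n : ℕ) : Set where
  vU : MV n
  vV : Fin n → MV n
  vW : Fin n → MV n

decode : ∀ {n} → Fin (suc (n + n)) → MV n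
decode zero = vU
decode {n} (suc i) with splitAt n i
... | inj₁ j = vV j
... | inj₂ j = vW j

madj : ∀ {n} → Graph n → MV n → MV n → Bool
madj G vU     vU     = false
madj G vU     (vV _) = false
madj G vU     (vW _) = true
madj G (vV _) vU     = false
madj G (vV i) (vV j) = adj G i j
madj G (vV i) (vW j) = adj G i j
madj G (vW _) vU     = true
madj G (vW i) (vV j) = adj G i j
madj G (vW _) (vW _) = false

madj-sym : ∀ {n} (G : Graph n) a b → madj G a b ≡ madj G b a
madj-sym G vU     vU     = refl
madj-sym G vU     (vV _) = refl
madj-sym G vU     (vW _) = refl
madj-sym G (vV _) vU     = refl
madj-sym G (vV i) (vV j) = sym G i j
madj-sym G (vV i) (vW j) = sym G i j
madj-sym G (vW _) vU     = refl
madj-sym G (vW i) (vV j) = sym G i j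
madj-sym G (vW _) (vW _) = refl

madj-irrefl : ∀ {n} (G : Graph n) a → madj G a a ≡ false
madj-irrefl G vU     = refl
madj-irrefl G (vV i) = irrefl G i
madj-irrefl G (vW _) = refl

Mycielski : ∀ {n} → Graph n → Graph (suc (n + n))
Mycielski G = record
  { adj    = λ x y → madj G (decode x) (decode y)
  ; sym    = λ x y → madj-sym G (decode x) (decode y)
  ; irrefl = λ x → madj-irrefl G (decode x)
  }

{-# OPTIONS --safe #-}
module Submission where

-- Take an OLD-set C of G, any vertex a, and D = {u} ∪ {v_i | i ∈ C} ∪ {u_a}.  The trace
-- of v_i or u_i on the v-layer is N_G(i) ∩ C, so two vertices of the same layer are
-- separated by C; u lies in the trace of every u_i and of no v_i; and the trace {u_a} of u
-- misses the v-layer, which the trace of every v_i meets.  The vertex u_a is there only to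
-- dominate u.  OLD-ness being
-- decidable, a minimum OLD-set of M(G) exists and has size at most |D| = γ_OLD(G) + 2.

open import Defs
open import Data.Nat using (ℕ; zero; suc; _+_; _≤_; _<_)
open import Data.Nat.Properties
  using (≤-refl; ≤-trans; ≤-reflexive; ≮⇒≥; m<1+n⇒m<n∨m≡n; +-suc; _≟_)
open import Data.Fin using (Fin; zero; suc; splitAt; _↑ˡ_; _↑ʳ_; join)
import Data.Fin as Fin
open import Data.Fin.Properties using (splitAt-↑ˡ; splitAt-↑ʳ; join-splitAt; all?; any?)
open import Data.Fin.Subset using (Subset; _∈_; ∣_∣; ⁅_⁆; inside)
open import Data.Fin.Subset.Properties using (x∈⁅x⁆; ∣⁅x⁆∣≡1; _∈?_; anySubset?)
open import Data.Bool using (Bool; true; false; _∧_)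
import Data.Bool as Bool
open import Data.Sum using (inj₁; inj₂; _⊎_)
open import Data.Vec using (lookup; _∷_; []; _++_)
open import Data.Vec.Properties using (lookup-splitAt; []=⇒lookup; lookup⇒[]=)
open import Data.Product using (∃; _×_; _,_; proj₁; proj₂)
open import Data.Empty using (⊥-elim)
open import Relation.Binary.PropositionalEquality
  using (_≡_; _≢_; refl; trans; cong; cong₂; subst; module ≡-Reasoning)
  renaming (sym to ≡-sym)
open import Relation.Nullary using (¬_; yes; no)
open import Relation.Nullary.Decidable using (_×-dec_; _→-dec_; ¬?)
open import Relation.Unary using (Pred; Decidable)

∣++∣ : ∀ {a b} (p : Subset a) (q : Subset b) → ∣ p ++ q ∣ ≡ ∣ p ∣ + ∣ q ∣
∣++∣ []          q = refl
∣++∣ (true  ∷ p) q = cong suc (∣++∣ p q)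
∣++∣ (false ∷ p) q = ∣++∣ p q

module LeastNumber {p} {P : Pred ℕ p} (P? : Decidable P) where

  Least : Set p
  Least = ∃ λ m → P m × (∀ j → P j → m ≤ j)

  least-or-none-below : ∀ b → Least ⊎ (∀ j → j < b → ¬ P j)
  least-or-none-below zero = inj₂ (λ _ ())
  least-or-none-below (suc b) with least-or-none-below b
  ... | inj₁ least = inj₁ least
  ... | inj₂ none with P? b
  ...   | yes pb = inj₁ (b , pb , λ j pj → ≮⇒≥ (λ j<b → none j j<b pj))
  ...   | no ¬pb = inj₂ none-below-suc
    where
    none-below-suc : ∀ j → j < suc b → ¬ P j
    none-below-suc j j<1+b pj with m<1+n⇒m<n∨m≡n j<1+b
    ... | inj₁ j<b  = none j j<b pj
    ... | inj₂ refl = ¬pb pj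

  least : ∀ {s} → P s → Least
  least {s} ps with least-or-none-below (suc s)
  ... | inj₁ l    = l
  ... | inj₂ none = ⊥-elim (none s ≤-refl ps)

isOLD? : ∀ {n} (G : Graph n) → Decidable (IsOLD G)
isOLD? G C =
  all? (λ x → any? (λ y → (adj G x y Bool.≟ true) ×-dec (y ∈? C)))
  ×-dec all? (λ x → all? (λ y →
    ¬? (x Fin.≟ y) →-dec ¬? (all? (λ z → NC G C x z Bool.≟ NC G C y z))))

γOLD-≤ : ∀ {n} (G : Graph n) {C : Subset n} → IsOLD G C → ∃ λ m → IsγOLD G m × m ≤ ∣ C ∣
γOLD-≤ G {C} C-old with least (C , C-old , refl)
  where
  open LeastNumber (λ j → anySubset? (λ E → isOLD? G E ×-dec (∣ E ∣ ≟ j)))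
... | m , optimal , minimal =
  m , (optimal , λ E E-old → minimal ∣ E ∣ (E , E-old , refl)) ,
  minimal ∣ C ∣ (C , C-old , refl)

encode : ∀ {n} → MV n → Fin (suc (n + n))
encode     vU     = zero
encode {n} (vV i) = suc (i ↑ˡ n)
encode {n} (vW i) = suc (n ↑ʳ i)

decode-encode : ∀ {n} (w : MV n) → decode (encode w) ≡ w
decode-encode     vU     = refl
decode-encode {n} (vV i) rewrite splitAt-↑ˡ n i n = refl
decode-encode {n} (vW i) rewrite splitAt-↑ʳ n n i = refl

encode-decode : ∀ {n} (x : Fin (suc (n + n))) → encode (decode {n} x) ≡ x
encode-decode     zero    = refl
encode-decode {n} (suc i) with splitAt n i in eq
... | inj₁ _ = cong suc (trans (cong (join n n) (≡-sym eq)) (join-splitAt n n i))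
... | inj₂ _ = cong suc (trans (cong (join n n) (≡-sym eq)) (join-splitAt n n i))

decode-injective : ∀ n {x y : Fin (suc (n + n))} → decode {n} x ≡ decode y → x ≡ y
decode-injective n {x} {y} eq =
  trans (≡-sym (encode-decode x)) (trans (cong encode eq) (encode-decode y))

module MycielskiOLD {n} (G : Graph n) {C : Subset n} (C-old : IsOLD G C) (a : Fin n) where

  D : Subset (suc (n + n))
  D = inside ∷ (C ++ ⁅ a ⁆)

  ∣D∣ : ∣ D ∣ ≡ ∣ C ∣ + 2
  ∣D∣ = begin
    suc ∣ C ++ ⁅ a ⁆ ∣      ≡⟨ cong suc (∣++∣ C ⁅ a ⁆) ⟩
    suc (∣ C ∣ + ∣ ⁅ a ⁆ ∣) ≡⟨ cong (λ k → suc (∣ C ∣ + k)) (∣⁅x⁆∣≡1 a) ⟩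
    suc (∣ C ∣ + 1)         ≡⟨ ≡-sym (+-suc ∣ C ∣ 1) ⟩
    ∣ C ∣ + 2               ∎
    where open ≡-Reasoning

  inD : MV n → Bool
  inD vU     = true
  inD (vV i) = lookup C i
  inD (vW i) = lookup ⁅ a ⁆ i

  lookup-D : ∀ x → lookup D x ≡ inD (decode x)
  lookup-D zero = refl
  lookup-D (suc i) rewrite lookup-splitAt n C ⁅ a ⁆ i with splitAt n i
  ... | inj₁ _ = refl
  ... | inj₂ _ = refl

  neighbour-in-C : ∀ i → ∃ λ c → adj G i c ≡ true × lookup C c ≡ true
  neighbour-in-C i with proj₁ C-old i
  ... | c , i~c , c∈C = c , i~c , []=⇒lookup c∈C

  neighbour-in-D : ∀ w → ∃ λ v → madj G w v ≡ true × inD v ≡ true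
  neighbour-in-D vU     = vW a , refl , []=⇒lookup (x∈⁅x⁆ a)
  neighbour-in-D (vV i) with neighbour-in-C i
  ... | c , i~c , c∈C = vV c , i~c , c∈C
  neighbour-in-D (vW i) = vU , refl , refl

  SameTrace : MV n → MV n → Set
  SameTrace p q = ∀ w → madj G p w ∧ inD w ≡ madj G q w ∧ inD w

  same-trace-sym : ∀ p q → SameTrace p q → SameTrace q p
  same-trace-sym _ _ same w = ≡-sym (same w)

  same-trace⇒≡ : ∀ p q → SameTrace p q → p ≡ q
  same-trace⇒≡ vU     vU     same = refl
  same-trace⇒≡ vU     (vV i) same with neighbour-in-C i
  ... | c , i~c , c∈C with trans (same (vV c)) (cong₂ _∧_ i~c c∈C)
  ...   | ()
  same-trace⇒≡ vU     (vW i) same with same vU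
  ... | ()
  same-trace⇒≡ (vV i) vU     same =
    ≡-sym (same-trace⇒≡ vU (vV i) (same-trace-sym (vV i) vU same))
  same-trace⇒≡ (vV i) (vV j) same with i Fin.≟ j
  ... | yes refl = refl
  ... | no  i≢j  = ⊥-elim (proj₂ C-old i j i≢j (λ z → same (vV z)))
  same-trace⇒≡ (vV i) (vW j) same with same vU
  ... | ()
  same-trace⇒≡ (vW i) vU     same =
    ≡-sym (same-trace⇒≡ vU (vW i) (same-trace-sym (vW i) vU same))
  same-trace⇒≡ (vW i) (vV j) same =
    ≡-sym (same-trace⇒≡ (vV j) (vW i) (same-trace-sym (vW i) (vV j) same))
  same-trace⇒≡ (vW i) (vW j) same with i Fin.≟ j
  ... | yes refl = refl
  ... | no  i≢j  = ⊥-elim (proj₂ C-old i j i≢j (λ z → same (vV z)))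

  D-old : IsOLD (Mycielski G) D
  D-old = dominating , locating
    where
    dominating : ∀ x → ∃ λ y → (y ∈N[ Mycielski G ] x) × (y ∈ D)
    dominating x with neighbour-in-D (decode x)
    ... | w , x~w , w∈D =
      encode w ,
      subst (λ v → madj G (decode x) v ≡ true) (≡-sym (decode-encode w)) x~w ,
      lookup⇒[]= (encode w) D
        (trans (lookup-D (encode w)) (trans (cong inD (decode-encode w)) w∈D))

    locating : ∀ x y → x ≢ y → ¬ (∀ z → NC (Mycielski G) D x z ≡ NC (Mycielski G) D y z)
    locating x y x≢y same =
      x≢y (decode-injective n (same-trace⇒≡ (decode x) (decode y) same′))
      where
      same′ : SameTrace (decode x) (decode y)
      same′ w with same (encode w)
      ... | eq rewrite lookup-D (encode w) | decode-encode w = eq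

theorem5 : ∀ {n : ℕ} (G : Graph n) → 0 < n → Connected G → NoIsolated G → NoFalseTwins G →
    ∀ (k : ℕ) → IsγOLD G k → ∃ λ m → IsγOLD (Mycielski G) m × m ≤ k + 2
theorem5 {suc _} G _ _ _ _ k ((C , C-old , ∣C∣≡k) , _) =
  let m , γ≡m , m≤∣D∣ = γOLD-≤ (Mycielski G) D-old
  in  m , γ≡m , ≤-trans m≤∣D∣ (≤-reflexive (trans ∣D∣ (cong (_+ 2) ∣C∣≡k)))
  where open MycielskiOLD G C-old zero
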